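{- Let $S=\frac{13591409}{545140134}$, $\varepsilon=53360^{ -3}$ and $s_k=\frac{(6k)!}{(3k)!\,(k!)^3}\cdot\frac{k+S}{640320^{3k}}$ for $k\ge0$. For every $n\ge1$ there is $\varphi_n$ with $0.05<\varphi_n<2.19$ and $$\frac{s_n}{\varepsilon\, s_{n-1}}=1-\frac{1}{2n}+\frac{\frac{5}{36}-S}{n^2}+\frac{\frac{5}{72}-\frac{S}{2}+S^2}{n^3}+\frac{\varphi_n}{n^4}.$$ If $n\ge2$, then $\varphi_n<0.11$ and $$\frac{s_n}{\varepsilon\, s_{n-1}}<\exp\left(-\frac{1}{2n}-\frac{S-\frac{1}{72}}{n^2}+\frac{0.67}{n^3}\right).$$ -}

module Defs where

open import Data.Nat as ℕ using (ℕ; zero; suc; _!)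
open import Data.Integer using (+_)
open import Data.Rational
  using (ℚ; _+_; _*_; _-_; _÷_; _/_; _<_; 0ℚ; 1ℚ; ≢-nonZero)
open import Data.Rational.Properties using (_≟_)
open import Data.Product using (∃-syntax; _×_)
open import Relation.Nullary using (yes; no)

ℕ→ℚ : ℕ → ℚ
ℕ→ℚ n = + n / 1

pow : ℚ → ℕ → ℚ
pow x zero    = 1ℚ
pow x (suc k) = x * pow x k

-- total division (convention: p / 0 = 0; only ever applied to nonzero
-- denominators in the statement)
_÷₀_ : ℚ → ℚ → ℚ
p ÷₀ q with q ≟ 0ℚ
... | yes _ = 0ℚ
... | no q≢0 = _÷_ p q {{≢-nonZero q≢0}}

infixl 7 _÷₀_

S : ℚ
S = + 13591409 / 545140134

ε : ℚ
ε = 1ℚ ÷₀ pow (ℕ→ℚ 53360) 3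

s : ℕ → ℚ
s k = (ℕ→ℚ ((6 ℕ.* k) !) ÷₀ (ℕ→ℚ ((3 ℕ.* k) !) * pow (ℕ→ℚ (k !)) 3))
      * ((ℕ→ℚ k + S) ÷₀ pow (ℕ→ℚ 640320) (3 ℕ.* k))

ratio : ℕ → ℚ
ratio n = s n ÷₀ (ε * s (n ℕ.∸ 1))

-- x < exp y, with exp y = lim_{m→∞} (1 + y/m)^m, the sequence being
-- strictly increasing once 1 + y/m > 0; hence x < exp y iff x is below
-- some term of the sequence with 1 + y/m > 0.
_<exp_ : ℚ → ℚ → Set
x <exp y = ∃[ m ] (1 ℕ.≤ m × 0ℚ < 1ℚ + y ÷₀ ℕ→ℚ m × x < pow (1ℚ + y ÷₀ ℕ→ℚ m) m)

infix 4 _<exp_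

{-# OPTIONS --safe #-}
-- With n = k + 1 the factorials in s telescope:
-- (6n)!/(6n - 6)! = 1728 (n - 1/6)(n - 1/2)(n - 5/6) · (3n)!/(3n - 3)!, and 640320³ ε = 12³ = 1728,
-- so s n / (ε s k) = (n - 1/6)(n - 1/2)(n - 5/6)(n + S) / (n³ (n - 1 + S)).
-- Dividing the numerator by n⁴ (n - 1 + S) gives the expansion with the exact remainder
-- φ n = c₄ n / (n - 1 + S); each bound on φ n is the positivity of an affine function of n - 1
-- (or n - 2) with positive coefficients.
-- For the exponential bound take m = n in the definition of _<exp_: with x = y / n, y the exponent,
-- it suffices that 1 + x > 0 and s n / (ε s k) < 1 + n x + C(n,2) x² + C(n,3) x³ ≤ (1 + x)ⁿ.
-- Multiplied out, both inequalities say that explicit polynomials in n - 2 with positive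
-- coefficients are positive.
module Submission where

open import Defs
open import Data.Integer.Base as ℤ using (+_)
import Data.Integer.Properties as ℤP
open import Data.List.Base using (List; []; _∷_)
open import Data.List.Relation.Unary.All using (All; []; _∷_; all?)
open import Data.Nat.Base as ℕ using (ℕ; zero; suc; _!)
open import Data.Nat.Combinatorics using (_C_; nC1≡n; nCk+nC[k+1]≡[n+1]C[k+1])
import Data.Nat.Properties as ℕP
open import Data.Rational
open import Data.Rational.Properties
import Data.Rational.Unnormalised.Base as ℚᵘ
import Data.Rational.Unnormalised.Properties as ℚᵘ
open import Data.Product.Base using (∃-syntax; _×_; _,_)
open import Data.Sum.Base using (inj₁; inj₂)
open import Level using (0ℓ)
open import Relation.Binary.PropositionalEquality
  using (_≡_; refl; sym; trans; cong; cong₂; subst; subst₂; module ≡-Reasoning)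
open import Relation.Nullary.Decidable using (True; dec⇒maybe; toWitness; yes; no)
open import Relation.Nullary.Negation using (contradiction)
open import Tactic.RingSolver using (solve-∀)
open import Tactic.RingSolver.Core.AlmostCommutativeRing
  using (AlmostCommutativeRing; fromCommutativeRing)

ringℚ : AlmostCommutativeRing 0ℓ 0ℓ
ringℚ = fromCommutativeRing +-*-commutativeRing (λ x → dec⇒maybe (0ℚ ≟ x))

toℚᵘ-ℕ→ℚ : ∀ n → toℚᵘ (ℕ→ℚ n) ℚᵘ.≃ ℚᵘ.mkℚᵘ (+ n) 0
toℚᵘ-ℕ→ℚ n = toℚᵘ-fromℚᵘ (ℚᵘ.mkℚᵘ (+ n) 0)

ℕ→ℚ-homo-+ : ∀ m n → ℕ→ℚ (m ℕ.+ n) ≡ ℕ→ℚ m + ℕ→ℚ n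
ℕ→ℚ-homo-+ m n = toℚᵘ-injective (begin
  toℚᵘ (ℕ→ℚ (m ℕ.+ n))                   ≈⟨ toℚᵘ-ℕ→ℚ (m ℕ.+ n) ⟩
  ℚᵘ.mkℚᵘ (+ m ℤ.+ + n) 0                   ≈⟨ ℚᵘ.≃-reflexive (cong (λ i → ℚᵘ.mkℚᵘ i 0) units) ⟩
  ℚᵘ.mkℚᵘ (+ m) 0 ℚᵘ.+ ℚᵘ.mkℚᵘ (+ n) 0      ≈⟨ ℚᵘ.+-cong (ℚᵘ.≃-sym (toℚᵘ-ℕ→ℚ m)) (ℚᵘ.≃-sym (toℚᵘ-ℕ→ℚ n)) ⟩
  toℚᵘ (ℕ→ℚ m) ℚᵘ.+ toℚᵘ (ℕ→ℚ n)           ≈⟨ ℚᵘ.≃-sym (toℚᵘ-homo-+ (ℕ→ℚ m) (ℕ→ℚ n)) ⟩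
  toℚᵘ (ℕ→ℚ m + ℕ→ℚ n)                    ∎)
  where
  open ℚᵘ.≃-Reasoning
  units : + m ℤ.+ + n ≡ + m ℤ.* + 1 ℤ.+ + n ℤ.* + 1
  units = sym (cong₂ ℤ._+_ (ℤP.*-identityʳ (+ m)) (ℤP.*-identityʳ (+ n)))

ℕ→ℚ-homo-* : ∀ m n → ℕ→ℚ (m ℕ.* n) ≡ ℕ→ℚ m * ℕ→ℚ n
ℕ→ℚ-homo-* m n = toℚᵘ-injective (begin
  toℚᵘ (ℕ→ℚ (m ℕ.* n))                   ≈⟨ toℚᵘ-ℕ→ℚ (m ℕ.* n) ⟩
  ℚᵘ.mkℚᵘ (+ (m ℕ.* n)) 0                  ≈⟨ ℚᵘ.≃-reflexive (cong (λ i → ℚᵘ.mkℚᵘ i 0) (ℤP.pos-* m n)) ⟩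
  ℚᵘ.mkℚᵘ (+ m) 0 ℚᵘ.* ℚᵘ.mkℚᵘ (+ n) 0      ≈⟨ ℚᵘ.*-cong (ℚᵘ.≃-sym (toℚᵘ-ℕ→ℚ m)) (ℚᵘ.≃-sym (toℚᵘ-ℕ→ℚ n)) ⟩
  toℚᵘ (ℕ→ℚ m) ℚᵘ.* toℚᵘ (ℕ→ℚ n)           ≈⟨ ℚᵘ.≃-sym (toℚᵘ-homo-* (ℕ→ℚ m) (ℕ→ℚ n)) ⟩
  toℚᵘ (ℕ→ℚ m * ℕ→ℚ n)                    ∎)
  where open ℚᵘ.≃-Reasoning

ℕ→ℚ-suc : ∀ n → ℕ→ℚ (suc n) ≡ 1ℚ + ℕ→ℚ n
ℕ→ℚ-suc = ℕ→ℚ-homo-+ 1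

0≤ℕ→ℚ : ∀ n → 0ℚ ≤ ℕ→ℚ n
0≤ℕ→ℚ n = nonNegative⁻¹ _ {{normalize-nonNeg n 1}}

0<ℕ→ℚ : ∀ n .{{_ : ℕ.NonZero n}} → 0ℚ < ℕ→ℚ n
0<ℕ→ℚ n = positive⁻¹ _ {{normalize-pos n 1}}

0<p*q : ∀ {p q} → 0ℚ < p → 0ℚ < q → 0ℚ < p * q
0<p*q {p} {q} 0<p 0<q = positive⁻¹ (p * q) {{pos*pos⇒pos p {{positive 0<p}} q {{positive 0<q}}}}

0≤p*q : ∀ {p q} → 0ℚ ≤ p → 0ℚ ≤ q → 0ℚ ≤ p * q
0≤p*q {p} {q} 0≤p 0≤q = nonNegative⁻¹ (p * q) {{nonNeg*nonNeg⇒nonNeg p {{nonNegative 0≤p}} q {{nonNegative 0≤q}}}}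

0<pow : ∀ {x} n → 0ℚ < x → 0ℚ < pow x n
0<pow zero    0<x = toWitness {a? = 0ℚ <? 1ℚ} _
0<pow (suc n) 0<x = 0<p*q 0<x (0<pow n 0<x)

0≤p*p : ∀ p → 0ℚ ≤ p * p
0≤p*p p with ≤-total 0ℚ p
... | inj₁ 0≤p = 0≤p*q 0≤p 0≤p
... | inj₂ p≤0 = nonNegative⁻¹ _ {{nonPos*nonPos⇒nonPos p {{nonPositive p≤0}} p {{nonPositive p≤0}}}}

p≤p+q : ∀ {p q} → 0ℚ ≤ q → p ≤ p + q
p≤p+q {p} 0≤q = subst (_≤ p + _) (+-identityʳ p) (+-monoʳ-≤ p 0≤q)

p<p+q : ∀ {p q} → 0ℚ < q → p < p + q
p<p+q {p} 0<q = subst (_< p + _) (+-identityʳ p) (+-monoʳ-< p 0<q)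

*-cancelʳ-≡ : ∀ {p q r} → 0ℚ < r → p * r ≡ q * r → p ≡ q
*-cancelʳ-≡ {r = r} 0<r pr≡qr = ≤-antisym
  (*-cancelʳ-≤-pos r {{positive 0<r}} (≤-reflexive pr≡qr))
  (*-cancelʳ-≤-pos r {{positive 0<r}} (≤-reflexive (sym pr≡qr)))

*-cancelʳ-< : ∀ {p q r} → 0ℚ < r → p * r < q * r → p < q
*-cancelʳ-< {r = r} 0<r = *-cancelʳ-<-nonNeg r {{pos⇒nonNeg r {{positive 0<r}}}}

÷₀-≡-÷ : ∀ p {q} (0<q : 0ℚ < q) → p ÷₀ q ≡ (p ÷ q) {{pos⇒nonZero q {{positive 0<q}}}}
÷₀-≡-÷ p {q} 0<q with q ≟ 0ℚ
... | yes q≡0 = contradiction (sym q≡0) (<⇒≢ 0<q)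
... | no _    = refl

p÷₀q*q≡p : ∀ p {q} → 0ℚ < q → p ÷₀ q * q ≡ p
p÷₀q*q≡p p {q} 0<q = begin
  p ÷₀ q * q      ≡⟨ cong (_* q) (÷₀-≡-÷ p 0<q) ⟩
  p * 1/ q * q    ≡⟨ *-assoc p _ q ⟩
  p * (1/ q * q)  ≡⟨ cong (p *_) (*-inverseˡ q) ⟩
  p * 1ℚ          ≡⟨ *-identityʳ p ⟩
  p               ∎
  where
  open ≡-Reasoning
  instance _ = pos⇒nonZero q {{positive 0<q}}

0<÷₀ : ∀ {p q} → 0ℚ < p → 0ℚ < q → 0ℚ < p ÷₀ q
0<÷₀ {p} {q} 0<p 0<q = *-cancelʳ-< 0<q
  (subst₂ _<_ (sym (*-zeroˡ q)) (sym (p÷₀q*q≡p p 0<q)) 0<p)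

÷₀-*-≡ : ∀ {p q x y} → 0ℚ < q → p * x ≡ q * y → p ÷₀ q * x ≡ y
÷₀-*-≡ {p} {q} {x} {y} 0<q px≡qy = *-cancelʳ-≡ 0<q (begin
  p ÷₀ q * x * q    ≡⟨ swap (p ÷₀ q) x q ⟩
  p ÷₀ q * q * x    ≡⟨ cong (_* x) (p÷₀q*q≡p p 0<q) ⟩
  p * x             ≡⟨ px≡qy ⟩
  q * y             ≡⟨ *-comm q y ⟩
  y * q             ∎)
  where
  open ≡-Reasoning
  swap : ∀ a b c → a * b * c ≡ a * c * b
  swap = solve-∀ ringℚ

*<⇒<÷₀ : ∀ {x p q} → 0ℚ < q → x * q < p → x < p ÷₀ q
*<⇒<÷₀ {x} {p} {q} 0<q xq<p = *-cancelʳ-< 0<q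
  (subst (x * q <_) (sym (p÷₀q*q≡p p 0<q)) xq<p)

<*⇒÷₀< : ∀ {x p q} → 0ℚ < q → p < x * q → p ÷₀ q < x
<*⇒÷₀< {x} {p} {q} 0<q p<xq = *-cancelʳ-< 0<q
  (subst (_< x * q) (sym (p÷₀q*q≡p p 0<q)) p<xq)

horner : List ℚ → ℚ → ℚ
horner []       x = 0ℚ
horner (c ∷ cs) x = c + x * horner cs x

horner-nonNeg : ∀ {cs x} → All (0ℚ ≤_) cs → 0ℚ ≤ x → 0ℚ ≤ horner cs x
horner-nonNeg []           0≤x = ≤-refl
horner-nonNeg (0≤c ∷ 0≤cs) 0≤x = +-mono-≤ 0≤c (0≤p*q 0≤x (horner-nonNeg 0≤cs 0≤x))

horner-pos : ∀ {cs x} → 0ℚ < horner cs 0ℚ → All (0ℚ ≤_) cs → 0ℚ ≤ x → 0ℚ < horner cs x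
horner-pos {[]}     0<0    _          _   = contradiction 0<0 (<-irrefl refl)
horner-pos {c ∷ cs} 0<c+0h (_ ∷ 0≤cs) 0≤x = +-mono-<-≤ 0<c (0≤p*q 0≤x (horner-nonNeg 0≤cs 0≤x))
  where
  0<c : 0ℚ < c
  0<c = subst (0ℚ <_) (trans (cong (_+_ c) (*-zeroˡ (horner cs 0ℚ))) (+-identityʳ c)) 0<c+0h

<-by-positive-polynomial : ∀ {p q x} cs → q ≡ p + horner cs x → 0ℚ ≤ x →
  {True (0ℚ <? horner cs 0ℚ)} → {True (all? (0ℚ ≤?_) cs)} → p < q
<-by-positive-polynomial {p} cs q≡p+h 0≤x {0<h₀} {0≤cs} =
  subst (p <_) (sym q≡p+h) (p<p+q (horner-pos (toWitness 0<h₀) (toWitness 0≤cs) 0≤x))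

-- The truncated binomial series

ℕ→ℚ-pascal : ∀ m k → ℕ→ℚ (suc m C suc k) ≡ ℕ→ℚ (m C k) + ℕ→ℚ (m C suc k)
ℕ→ℚ-pascal m k = trans (cong ℕ→ℚ (sym (nCk+nC[k+1]≡[n+1]C[k+1] m k))) (ℕ→ℚ-homo-+ (m C k) (m C suc k))

ℕ→ℚ-nC2 : ∀ m → ℕ→ℚ (m C 2) ≡ ℕ→ℚ m * (ℕ→ℚ m - 1ℚ) * ½
ℕ→ℚ-nC2 zero    = refl
ℕ→ℚ-nC2 (suc m) = begin
  ℕ→ℚ (suc m C 2)                      ≡⟨ ℕ→ℚ-pascal m 1 ⟩
  ℕ→ℚ (m C 1) + ℕ→ℚ (m C 2)            ≡⟨ cong₂ _+_ (cong ℕ→ℚ (nC1≡n m)) (ℕ→ℚ-nC2 m) ⟩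
  M + M * (M - 1ℚ) * ½                 ≡⟨ shift M ⟩
  (1ℚ + M) * ((1ℚ + M) - 1ℚ) * ½       ≡⟨ cong (λ N → N * (N - 1ℚ) * ½) (sym (ℕ→ℚ-suc m)) ⟩
  ℕ→ℚ (suc m) * (ℕ→ℚ (suc m) - 1ℚ) * ½ ∎
  where
  open ≡-Reasoning
  M = ℕ→ℚ m
  shift : ∀ M → M + M * (M - 1ℚ) * ½ ≡ (1ℚ + M) * ((1ℚ + M) - 1ℚ) * ½
  shift = solve-∀ ringℚ

ℕ→ℚ-nC3 : ∀ m → ℕ→ℚ (m C 3) ≡ ℕ→ℚ m * (ℕ→ℚ m - 1ℚ) * (ℕ→ℚ m - ℕ→ℚ 2) * (+ 1 / 6)
ℕ→ℚ-nC3 zero    = refl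
ℕ→ℚ-nC3 (suc m) = begin
  ℕ→ℚ (suc m C 3)                                   ≡⟨ ℕ→ℚ-pascal m 2 ⟩
  ℕ→ℚ (m C 2) + ℕ→ℚ (m C 3)                         ≡⟨ cong₂ _+_ (ℕ→ℚ-nC2 m) (ℕ→ℚ-nC3 m) ⟩
  M * (M - 1ℚ) * ½ + M * (M - 1ℚ) * (M - ℕ→ℚ 2) * (+ 1 / 6)
    ≡⟨ shift M ⟩
  (1ℚ + M) * ((1ℚ + M) - 1ℚ) * ((1ℚ + M) - ℕ→ℚ 2) * (+ 1 / 6)
    ≡⟨ cong (λ N → N * (N - 1ℚ) * (N - ℕ→ℚ 2) * (+ 1 / 6)) (sym (ℕ→ℚ-suc m)) ⟩
  ℕ→ℚ (suc m) * (ℕ→ℚ (suc m) - 1ℚ) * (ℕ→ℚ (suc m) - ℕ→ℚ 2) * (+ 1 / 6) ∎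
  where
  open ≡-Reasoning
  M = ℕ→ℚ m
  shift : ∀ M → M * (M - 1ℚ) * ½ + M * (M - 1ℚ) * (M - ℕ→ℚ 2) * (+ 1 / 6)
              ≡ (1ℚ + M) * ((1ℚ + M) - 1ℚ) * ((1ℚ + M) - ℕ→ℚ 2) * (+ 1 / 6)
  shift = solve-∀ ringℚ

truncBinomial : ℚ → ℕ → ℚ
truncBinomial x m = 1ℚ + ℕ→ℚ m * x + ℕ→ℚ (m C 2) * (x * x) + ℕ→ℚ (m C 3) * (x * (x * x))

truncBinomial≤pow : ∀ {x} → 0ℚ ≤ 1ℚ + x → ∀ m → truncBinomial x m ≤ pow (1ℚ + x) m
truncBinomial≤pow {x} _ zero = ≤-reflexive (empty x)
  where
  empty : ∀ x → 1ℚ + ℕ→ℚ 0 * x + ℕ→ℚ 0 * (x * x) + ℕ→ℚ 0 * (x * (x * x)) ≡ 1ℚ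
  empty = solve-∀ ringℚ
truncBinomial≤pow {x} 0≤1+x (suc m) = begin
  truncBinomial x (suc m)
    ≡⟨ pascal ⟩
  1ℚ + (1ℚ + M) * x + (M + c₂) * (x * x) + (c₂ + c₃) * (x * (x * x))
    ≤⟨ p≤p+q (0≤p*q (0≤ℕ→ℚ (m C 3)) (0≤p*p (x * x))) ⟩
  1ℚ + (1ℚ + M) * x + (M + c₂) * (x * x) + (c₂ + c₃) * (x * (x * x)) + c₃ * ((x * x) * (x * x))
    ≡⟨ multiply x M c₂ c₃ ⟩
  (1ℚ + x) * truncBinomial x m
    ≤⟨ *-monoˡ-≤-nonNeg (1ℚ + x) {{nonNegative 0≤1+x}} (truncBinomial≤pow 0≤1+x m) ⟩
  pow (1ℚ + x) (suc m) ∎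
  where
  open ≤-Reasoning
  M = ℕ→ℚ m
  c₂ = ℕ→ℚ (m C 2)
  c₃ = ℕ→ℚ (m C 3)
  pascal : 1ℚ + ℕ→ℚ (suc m) * x + ℕ→ℚ (suc m C 2) * (x * x) + ℕ→ℚ (suc m C 3) * (x * (x * x))
         ≡ 1ℚ + (1ℚ + M) * x + (M + c₂) * (x * x) + (c₂ + c₃) * (x * (x * x))
  pascal = cong₂ _+_
    (cong₂ (λ a b → 1ℚ + a * x + b * (x * x)) (ℕ→ℚ-suc m)
      (trans (ℕ→ℚ-pascal m 1) (cong (λ k → ℕ→ℚ k + c₂) (nC1≡n m))))
    (cong (_* (x * (x * x))) (ℕ→ℚ-pascal m 2))
  multiply : ∀ x M c₂ c₃ →
    1ℚ + (1ℚ + M) * x + (M + c₂) * (x * x) + (c₂ + c₃) * (x * (x * x)) + c₃ * ((x * x) * (x * x))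
    ≡ (1ℚ + x) * (1ℚ + M * x + c₂ * (x * x) + c₃ * (x * (x * x)))
  multiply = solve-∀ ringℚ

-- The recurrence of s

rising : ℕ → ℚ → ℚ
rising zero    x = 1ℚ
rising (suc j) x = (ℕ→ℚ (suc j) + x) * rising j x

ℕ→ℚ-[m+n]! : ∀ m n → ℕ→ℚ ((m ℕ.+ n) !) ≡ rising m (ℕ→ℚ n) * ℕ→ℚ (n !)
ℕ→ℚ-[m+n]! zero    n = sym (*-identityˡ (ℕ→ℚ (n !)))
ℕ→ℚ-[m+n]! (suc m) n = begin
  ℕ→ℚ ((suc m ℕ.+ n) !)                          ≡⟨ ℕ→ℚ-homo-* (suc m ℕ.+ n) ((m ℕ.+ n) !) ⟩
  ℕ→ℚ (suc m ℕ.+ n) * ℕ→ℚ ((m ℕ.+ n) !)         ≡⟨ cong₂ _*_ (ℕ→ℚ-homo-+ (suc m) n) (ℕ→ℚ-[m+n]! m n) ⟩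
  (ℕ→ℚ (suc m) + N) * (rising m N * ℕ→ℚ (n !))   ≡⟨ *-assoc (ℕ→ℚ (suc m) + N) (rising m N) (ℕ→ℚ (n !)) ⟨
  rising (suc m) N * ℕ→ℚ (n !)                   ∎
  where
  open ≡-Reasoning
  N = ℕ→ℚ n

ℕ→ℚ-[m*[1+n]]! : ∀ m n → ℕ→ℚ ((m ℕ.* suc n) !) ≡ rising m (ℕ→ℚ m * ℕ→ℚ n) * ℕ→ℚ ((m ℕ.* n) !)
ℕ→ℚ-[m*[1+n]]! m n rewrite ℕP.*-suc m n =
  trans (ℕ→ℚ-[m+n]! m (m ℕ.* n)) (cong (λ x → rising m x * ℕ→ℚ ((m ℕ.* n) !)) (ℕ→ℚ-homo-* m n))

0<S : 0ℚ < S
0<S = toWitness {a? = 0ℚ <? S} _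

0<ε : 0ℚ < ε
0<ε = toWitness {a? = 0ℚ <? ε} _

0<ℕ→ℚ+S : ∀ n → 0ℚ < ℕ→ℚ n + S
0<ℕ→ℚ+S n = +-mono-≤-< (0≤ℕ→ℚ n) 0<S

0<ℕ→ℚ[n!] : ∀ n → 0ℚ < ℕ→ℚ (n !)
0<ℕ→ℚ[n!] n = 0<ℕ→ℚ (n !) {{n ℕP.!≢0}}

multinomial : ℕ → ℚ
multinomial k = ℕ→ℚ ((6 ℕ.* k) !) ÷₀ (ℕ→ℚ ((3 ℕ.* k) !) * pow (ℕ→ℚ (k !)) 3)

geometric : ℕ → ℚ
geometric k = (ℕ→ℚ k + S) ÷₀ pow (ℕ→ℚ 640320) (3 ℕ.* k)

0<multinomialDenominator : ∀ k → 0ℚ < ℕ→ℚ ((3 ℕ.* k) !) * pow (ℕ→ℚ (k !)) 3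
0<multinomialDenominator k = 0<p*q (0<ℕ→ℚ[n!] (3 ℕ.* k)) (0<pow 3 (0<ℕ→ℚ[n!] k))

0<640320^ : ∀ m → 0ℚ < pow (ℕ→ℚ 640320) m
0<640320^ m = 0<pow m (0<ℕ→ℚ 640320)

0<s : ∀ k → 0ℚ < s k
0<s k = 0<p*q (0<÷₀ (0<ℕ→ℚ[n!] (6 ℕ.* k)) (0<multinomialDenominator k))
              (0<÷₀ (0<ℕ→ℚ+S k) (0<640320^ (3 ℕ.* k)))

numeratorCubic : ℚ → ℚ
numeratorCubic n = (n - + 1 / 6) * (n - + 1 / 2) * (n - + 5 / 6)

ratioNumerator : ℚ → ℚ
ratioNumerator n = numeratorCubic n * (n + S)

multinomial-suc : ∀ k → let n = ℕ→ℚ (suc k) in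
  multinomial (suc k) * pow n 3 ≡ ℕ→ℚ 1728 * numeratorCubic n * multinomial k
multinomial-suc k = ÷₀-*-≡ (0<multinomialDenominator (suc k)) (begin
  ℕ→ℚ ((6 ℕ.* suc k) !) * pow n 3
    ≡⟨ cong (_* pow n 3) (ℕ→ℚ-[m*[1+n]]! 6 k) ⟩
  rising 6 (ℕ→ℚ 6 * K) * F₆ * pow n 3
    ≡⟨ cong (λ r → r * F₆ * pow n 3) (rising-ratio K) ⟩
  ℕ→ℚ 1728 * numeratorCubic (1ℚ + K) * rising 3 (ℕ→ℚ 3 * K) * F₆ * pow n 3
    ≡⟨ cong₂ (λ m f → ℕ→ℚ 1728 * numeratorCubic m * rising 3 (ℕ→ℚ 3 * K) * f * pow n 3)
             (sym (ℕ→ℚ-suc k)) (sym (p÷₀q*q≡p F₆ (0<multinomialDenominator k))) ⟩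
  ℕ→ℚ 1728 * numeratorCubic n * rising 3 (ℕ→ℚ 3 * K) * (multinomial k * (F₃ * pow F₁ 3)) * pow n 3
    ≡⟨ regroup (ℕ→ℚ 1728) (numeratorCubic n) (rising 3 (ℕ→ℚ 3 * K)) (multinomial k) F₃ F₁ n ⟩
  rising 3 (ℕ→ℚ 3 * K) * F₃ * pow (n * F₁) 3 * (ℕ→ℚ 1728 * numeratorCubic n * multinomial k)
    ≡⟨ cong₂ (λ a b → a * pow b 3 * (ℕ→ℚ 1728 * numeratorCubic n * multinomial k))
             (sym (ℕ→ℚ-[m*[1+n]]! 3 k)) (sym (ℕ→ℚ-homo-* (suc k) (k !))) ⟩
  ℕ→ℚ ((3 ℕ.* suc k) !) * pow (ℕ→ℚ (suc k !)) 3 * (ℕ→ℚ 1728 * numeratorCubic n * multinomial k) ∎)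
  where
  open ≡-Reasoning
  n = ℕ→ℚ (suc k)
  K = ℕ→ℚ k
  F₆ = ℕ→ℚ ((6 ℕ.* k) !)
  F₃ = ℕ→ℚ ((3 ℕ.* k) !)
  F₁ = ℕ→ℚ (k !)
  rising-ratio : ∀ K → let x = ℕ→ℚ 6 * K ; y = ℕ→ℚ 3 * K ; m = 1ℚ + K in
    (ℕ→ℚ 6 + x) * ((ℕ→ℚ 5 + x) * ((ℕ→ℚ 4 + x) * ((ℕ→ℚ 3 + x) * ((ℕ→ℚ 2 + x) * ((ℕ→ℚ 1 + x) * 1ℚ)))))
    ≡ ℕ→ℚ 1728 * ((m - + 1 / 6) * (m - + 1 / 2) * (m - + 5 / 6))
      * ((ℕ→ℚ 3 + y) * ((ℕ→ℚ 2 + y) * ((ℕ→ℚ 1 + y) * 1ℚ)))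
  rising-ratio = solve-∀ ringℚ
  regroup : ∀ t c r a f₃ f₁ n →
    t * c * r * (a * (f₃ * (f₁ * (f₁ * (f₁ * 1ℚ))))) * (n * (n * (n * 1ℚ)))
    ≡ r * f₃ * ((n * f₁) * ((n * f₁) * ((n * f₁) * 1ℚ))) * (t * c * a)
  regroup = solve-∀ ringℚ

geometric-suc : ∀ k → let P = ℕ→ℚ 640320 in
  geometric (suc k) * (pow P 3 * (ℕ→ℚ k + S)) ≡ (ℕ→ℚ (suc k) + S) * geometric k
geometric-suc k = ÷₀-*-≡ (0<640320^ (3 ℕ.* suc k)) (sym (begin
  pow P (3 ℕ.* suc k) * ((n + S) * geometric k)
    ≡⟨ cong (λ e → pow P e * ((n + S) * geometric k)) (ℕP.*-suc 3 k) ⟩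
  P * (P * (P * pow P (3 ℕ.* k))) * ((n + S) * geometric k)
    ≡⟨ regroup P (pow P (3 ℕ.* k)) (n + S) (geometric k) ⟩
  (n + S) * (pow P 3 * (geometric k * pow P (3 ℕ.* k)))
    ≡⟨ cong (λ d → (n + S) * (pow P 3 * d)) (p÷₀q*q≡p (ℕ→ℚ k + S) (0<640320^ (3 ℕ.* k))) ⟩
  (n + S) * (pow P 3 * (ℕ→ℚ k + S)) ∎))
  where
  open ≡-Reasoning
  P = ℕ→ℚ 640320
  n = ℕ→ℚ (suc k)
  regroup : ∀ P Q a g → P * (P * (P * Q)) * (a * g) ≡ a * (P * (P * (P * 1ℚ)) * (g * Q))
  regroup = solve-∀ ringℚ

s-suc : ∀ k → let n = ℕ→ℚ (suc k) in
  s (suc k) * (pow n 3 * (ℕ→ℚ k + S)) ≡ ε * s k * ratioNumerator n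
s-suc k = begin
  multinomial (suc k) * geometric (suc k) * (pow n 3 * D)
    ≡⟨ regroup₁ (multinomial (suc k)) (geometric (suc k)) (pow n 3) D ⟩
  multinomial (suc k) * pow n 3 * (geometric (suc k) * D)
  -- 640320 = 12 · 53360, so 1728 = ε · 640320³ holds by evaluation.
    ≡⟨ cong (_* (geometric (suc k) * D)) (multinomial-suc k) ⟩
  ε * pow P 3 * cubic * multinomial k * (geometric (suc k) * D)
    ≡⟨ regroup₂ ε (pow P 3) cubic (multinomial k) (geometric (suc k)) D ⟩
  ε * (cubic * multinomial k) * (geometric (suc k) * (pow P 3 * D))
    ≡⟨ cong (λ g → ε * (cubic * multinomial k) * g) (geometric-suc k) ⟩
  ε * (cubic * multinomial k) * ((n + S) * geometric k)
    ≡⟨ regroup₃ ε cubic (multinomial k) (n + S) (geometric k) ⟩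
  ε * s k * ratioNumerator n ∎
  where
  open ≡-Reasoning
  n = ℕ→ℚ (suc k)
  D = ℕ→ℚ k + S
  P = ℕ→ℚ 640320
  cubic = numeratorCubic n
  regroup₁ : ∀ a g m d → a * g * (m * d) ≡ a * m * (g * d)
  regroup₁ = solve-∀ ringℚ
  regroup₂ : ∀ e p c a g d → e * p * c * a * (g * d) ≡ e * (c * a) * (g * (p * d))
  regroup₂ = solve-∀ ringℚ
  regroup₃ : ∀ e c a b g → e * (c * a) * (b * g) ≡ e * (a * g) * (c * b)
  regroup₃ = solve-∀ ringℚ

ratio-suc : ∀ k → let n = ℕ→ℚ (suc k) in
  ratio (suc k) * (pow n 3 * (ℕ→ℚ k + S)) ≡ ratioNumerator n
ratio-suc k = ÷₀-*-≡ (0<p*q 0<ε (0<s k)) (s-suc k)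

-- The expansion of the ratio

-- c₄ · n is the remainder of ratioNumerator n · n on division by n - 1 + S.
c₄ : ℚ
c₄ = + 5 / 72 - + 23 / 36 * S + + 3 / 2 * S * S - S * S * S

φ : ℕ → ℚ
φ n = c₄ * ℕ→ℚ n ÷₀ (ℕ→ℚ (n ℕ.∸ 1) + S)

ratio-expansion : ∀ k → let n = ℕ→ℚ (suc k) in
  ratio (suc k) ≡ 1ℚ - 1ℚ ÷₀ ℕ→ℚ (2 ℕ.* suc k) + (+ 5 / 36 - S) ÷₀ pow n 2
                  + (+ 5 / 72 - S ÷₀ ℕ→ℚ 2 + S * S) ÷₀ pow n 3 + φ (suc k) ÷₀ pow n 4
ratio-expansion k = sym (*-cancelʳ-≡ (0<p*q (0<pow 4 0<n) (0<ℕ→ℚ+S k)) (begin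
  (1ℚ - t₁ + t₂ + t₃ + t₄) * (pow n 4 * D)
    ≡⟨ distribute t₁ t₂ t₃ t₄ n D ⟩
  expand n (t₁ * (ℕ→ℚ 2 * n)) (t₂ * pow n 2) (t₃ * pow n 3) (t₄ * pow n 4 * D)
    ≡⟨ cong₂ (λ b₁ b₂ → expand n b₁ b₂ (t₃ * pow n 3) (t₄ * pow n 4 * D))
             (trans (cong (t₁ *_) (sym (ℕ→ℚ-homo-* 2 (suc k)))) (p÷₀q*q≡p 1ℚ (0<ℕ→ℚ (2 ℕ.* suc k))))
             (p÷₀q*q≡p a₂ (0<pow 2 0<n)) ⟩
  expand n 1ℚ a₂ (t₃ * pow n 3) (t₄ * pow n 4 * D)
    ≡⟨ cong₂ (expand n 1ℚ a₂)
             (p÷₀q*q≡p a₃ (0<pow 3 0<n))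
             (trans (cong (_* D) (p÷₀q*q≡p (φ (suc k)) (0<pow 4 0<n))) (p÷₀q*q≡p (c₄ * n) (0<ℕ→ℚ+S k))) ⟩
  expand n 1ℚ a₂ a₃ (c₄ * n)
    ≡⟨ cong (λ m → expand m 1ℚ a₂ a₃ (c₄ * m)) (ℕ→ℚ-suc k) ⟩
  expand (1ℚ + K) 1ℚ a₂ a₃ (c₄ * (1ℚ + K))
    ≡⟨ division K S ⟩
  ratioNumerator (1ℚ + K) * (1ℚ + K)
    ≡⟨ cong (λ m → ratioNumerator m * m) (ℕ→ℚ-suc k) ⟨
  ratioNumerator n * n
    ≡⟨ cong (_* n) (ratio-suc k) ⟨
  ratio (suc k) * (pow n 3 * D) * n
    ≡⟨ regroup (ratio (suc k)) n D ⟨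
  ratio (suc k) * (pow n 4 * D) ∎))
  where
  open ≡-Reasoning
  n = ℕ→ℚ (suc k)
  K = ℕ→ℚ k
  D = K + S
  0<n = 0<ℕ→ℚ (suc k)
  a₂ = + 5 / 36 - S
  a₃ = + 5 / 72 - S ÷₀ ℕ→ℚ 2 + S * S
  t₁ = 1ℚ ÷₀ ℕ→ℚ (2 ℕ.* suc k)
  t₂ = a₂ ÷₀ pow n 2
  t₃ = a₃ ÷₀ pow n 3
  t₄ = φ (suc k) ÷₀ pow n 4
  expand : ℚ → ℚ → ℚ → ℚ → ℚ → ℚ
  expand m b₁ b₂ b₃ r = pow m 4 * D - b₁ * (½ * pow m 3 * D) + b₂ * (pow m 2 * D) + b₃ * (m * D) + r
  regroup : ∀ r n D → r * (n * (n * (n * (n * 1ℚ))) * D) ≡ r * (n * (n * (n * 1ℚ)) * D) * n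
  regroup = solve-∀ ringℚ
  distribute : ∀ t₁ t₂ t₃ t₄ n D →
    (1ℚ - t₁ + t₂ + t₃ + t₄) * (n * (n * (n * (n * 1ℚ))) * D)
    ≡ n * (n * (n * (n * 1ℚ))) * D - t₁ * (ℕ→ℚ 2 * n) * (½ * (n * (n * (n * 1ℚ))) * D)
      + t₂ * (n * (n * 1ℚ)) * (n * (n * 1ℚ) * D) + t₃ * (n * (n * (n * 1ℚ))) * (n * D)
      + t₄ * (n * (n * (n * (n * 1ℚ)))) * D
  distribute = solve-∀ ringℚ
  -- At s = S, the coefficient s * ½ is S ÷₀ ℕ→ℚ 2 by evaluation.
  division : ∀ K s → let m = 1ℚ + K ; D = K + s in
    m * (m * (m * (m * 1ℚ))) * D - 1ℚ * (½ * (m * (m * (m * 1ℚ))) * D)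
      + (+ 5 / 36 - s) * (m * (m * 1ℚ) * D) + (+ 5 / 72 - s * ½ + s * s) * (m * D)
      + (+ 5 / 72 - + 23 / 36 * s + + 3 / 2 * s * s - s * s * s) * m
    ≡ (m - + 1 / 6) * (m - + 1 / 2) * (m - + 5 / 6) * (m + s) * m
  division = solve-∀ ringℚ

φ-bounds : ∀ k → + 1 / 20 < φ (suc k) × φ (suc k) < + 219 / 100
φ-bounds k = *<⇒<÷₀ 0<D (<-by-positive-polynomial lowerGap lower (0≤ℕ→ℚ k))
           , <*⇒÷₀< 0<D (<-by-positive-polynomial upperGap upper (0≤ℕ→ℚ k))
  where
  K = ℕ→ℚ k
  0<D = 0<ℕ→ℚ+S k
  lowerGap = c₄ - + 1 / 20 * S ∷ c₄ - + 1 / 20 ∷ []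
  upperGap = + 219 / 100 * S - c₄ ∷ + 219 / 100 - c₄ ∷ []
  below : ∀ c q K s → c * (1ℚ + K) ≡ q * (K + s) + ((c - q * s) + K * ((c - q) + K * 0ℚ))
  below = solve-∀ ringℚ
  above : ∀ c q K s → q * (K + s) ≡ c * (1ℚ + K) + ((q * s - c) + K * ((q - c) + K * 0ℚ))
  above = solve-∀ ringℚ
  lower : c₄ * ℕ→ℚ (suc k) ≡ + 1 / 20 * (K + S) + horner lowerGap K
  lower = trans (cong (c₄ *_) (ℕ→ℚ-suc k)) (below c₄ (+ 1 / 20) K S)
  upper : + 219 / 100 * (K + S) ≡ c₄ * ℕ→ℚ (suc k) + horner upperGap K
  upper = trans (above c₄ (+ 219 / 100) K S) (cong (λ m → c₄ * m + horner upperGap K) (sym (ℕ→ℚ-suc k)))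

φ<11/100 : ∀ j → φ (2 ℕ.+ j) < + 11 / 100
φ<11/100 j = <*⇒÷₀< (0<ℕ→ℚ+S (suc j)) (<-by-positive-polynomial cs gap (0≤ℕ→ℚ j))
  where
  J = ℕ→ℚ j
  q = + 11 / 100
  cs = q * (1ℚ + S) - ℕ→ℚ 2 * c₄ ∷ q - c₄ ∷ []
  split : ∀ c q J s → q * ((1ℚ + J) + s) ≡ c * (ℕ→ℚ 2 + J) + ((q * (1ℚ + s) - ℕ→ℚ 2 * c) + J * ((q - c) + J * 0ℚ))
  split = solve-∀ ringℚ
  gap : q * (ℕ→ℚ (suc j) + S) ≡ c₄ * ℕ→ℚ (2 ℕ.+ j) + horner cs J
  gap = begin
    q * (ℕ→ℚ (suc j) + S)                 ≡⟨ cong (λ K → q * (K + S)) (ℕ→ℚ-suc j) ⟩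
    q * ((1ℚ + J) + S)                    ≡⟨ split c₄ q J S ⟩
    c₄ * (ℕ→ℚ 2 + J) + horner cs J        ≡⟨ cong (λ m → c₄ * m + horner cs J) (ℕ→ℚ-homo-+ 2 j) ⟨
    c₄ * ℕ→ℚ (2 ℕ.+ j) + horner cs J      ∎
    where open ≡-Reasoning

-- The exponential bound

exponent : ℕ → ℚ
exponent n = - (1ℚ ÷₀ ℕ→ℚ (2 ℕ.* n)) - (S - + 1 / 72) ÷₀ pow (ℕ→ℚ n) 2 + (+ 67 / 100) ÷₀ pow (ℕ→ℚ n) 3

-- (1 + x) n⁴ for x = exponent n / n, as a polynomial in j = n - 2 (with s = S).
baseCoefficients : ℚ → List ℚ
baseCoefficients s =
  (+ 3307 / 225 - + 2 / 1 * s) ∷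
  (+ 2161 / 72 - s) ∷
  (+ 47 / 2) ∷
  (+ 8 / 1) ∷
  (+ 1 / 1) ∷
  []

-- (truncBinomial x n - ratio n) · n¹¹ (n - 1 + S) for x = exponent n / n,
-- as a polynomial in j = n - 2 (with s = S).
gapCoefficients : ℚ → List ℚ
gapCoefficients s =
  (+ 4329992 / 50625 + + 22099592 / 50625 * s - + 98624 / 225 * (s * s) + + 32 / 1 * (s * s * s)) ∷
  (+ 30131305543 / 68343750 + + 133426365193 / 68343750 * s - + 98156599 / 50625 * (s * s) + + 27914 / 225 * (s * s * s) - + 4 / 3 * (s * s * s * s)) ∷
  (+ 544553371513 / 546750000 + + 2138572515269 / 546750000 * s - + 194233036 / 50625 * (s * s) + + 181937 / 900 * (s * s * s) - + 10 / 3 * (s * s * s * s)) ∷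
  (+ 5688834601777 / 4374000000 + + 89530228243 / 19440000 * s - + 535822859 / 120000 * (s * s) + + 2722 / 15 * (s * s * s) - + 3 / 1 * (s * s * s * s)) ∷
  (+ 1519391391121 / 1399680000 + + 982226007389 / 279936000 * s - + 873715171 / 259200 * (s * s) + + 353581 / 3600 * (s * s * s) - + 7 / 6 * (s * s * s * s)) ∷
  (+ 421219739311 / 699840000 + + 2508210203701 / 1399680000 * s - + 88754333 / 51840 * (s * s) + + 4669 / 144 * (s * s * s) - + 1 / 6 * (s * s * s * s)) ∷
  (+ 310797894001 / 1399680000 + + 317755547 / 518400 * s - + 351127 / 600 * (s * s) + + 73 / 12 * (s * s * s)) ∷
  (+ 1010489 / 19200 + + 35060803 / 259200 * s - + 1169 / 9 * (s * s) + + 1 / 2 * (s * s * s)) ∷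
  (+ 1886731 / 259200 + + 15703 / 900 * s - + 17 / 1 * (s * s)) ∷
  (+ 403 / 900 + s - (s * s)) ∷
  []

module ExpBound (j : ℕ) where

  private
    n = ℕ→ℚ (2 ℕ.+ j)
    J = ℕ→ℚ j
    D = ℕ→ℚ (suc j) + S
    x = exponent (2 ℕ.+ j) ÷₀ n
    0<n = 0<ℕ→ℚ (2 ℕ.+ j)
    n≡2+J : n ≡ ℕ→ℚ 2 + J
    n≡2+J = ℕ→ℚ-homo-+ 2 j

    z : ℚ → ℚ
    z m = - (1ℚ * (½ * (m * m))) - (S - + 1 / 72) * m + + 67 / 100

    x*n⁴≡z : x * pow n 4 ≡ z n
    x*n⁴≡z = begin
      x * pow n 4
        ≡⟨ regroup x n ⟩
      x * n * pow n 3
        ≡⟨ cong (_* pow n 3) (p÷₀q*q≡p (exponent (2 ℕ.+ j)) 0<n) ⟩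
      (- t₁ - t₂ + t₃) * pow n 3
        ≡⟨ distribute t₁ t₂ t₃ n ⟩
      quadratic (t₁ * (ℕ→ℚ 2 * n)) (t₂ * pow n 2) (t₃ * pow n 3)
        ≡⟨ cong₂ (λ b₁ b₂ → quadratic b₁ b₂ (t₃ * pow n 3))
                 (trans (cong (t₁ *_) (sym (ℕ→ℚ-homo-* 2 (2 ℕ.+ j)))) (p÷₀q*q≡p 1ℚ (0<ℕ→ℚ (2 ℕ.* (2 ℕ.+ j)))))
                 (p÷₀q*q≡p (S - + 1 / 72) (0<pow 2 0<n)) ⟩
      quadratic 1ℚ (S - + 1 / 72) (t₃ * pow n 3)
        ≡⟨ cong (quadratic 1ℚ (S - + 1 / 72)) (p÷₀q*q≡p (+ 67 / 100) (0<pow 3 0<n)) ⟩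
      z n ∎
      where
      open ≡-Reasoning
      t₁ = 1ℚ ÷₀ ℕ→ℚ (2 ℕ.* (2 ℕ.+ j))
      t₂ = (S - + 1 / 72) ÷₀ pow n 2
      t₃ = (+ 67 / 100) ÷₀ pow n 3
      quadratic : ℚ → ℚ → ℚ → ℚ
      quadratic b₁ b₂ b₃ = - (b₁ * (½ * (n * n))) - b₂ * n + b₃
      regroup : ∀ x n → x * (n * (n * (n * (n * 1ℚ)))) ≡ x * n * (n * (n * (n * 1ℚ)))
      regroup = solve-∀ ringℚ
      distribute : ∀ t₁ t₂ t₃ n →
        (- t₁ - t₂ + t₃) * (n * (n * (n * 1ℚ)))
        ≡ - (t₁ * (ℕ→ℚ 2 * n) * (½ * (n * n))) - t₂ * (n * (n * 1ℚ)) * n + t₃ * (n * (n * (n * 1ℚ)))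
      distribute = solve-∀ ringℚ

  0<1+x : 0ℚ < 1ℚ + x
  0<1+x = *-cancelʳ-< (0<pow 4 0<n)
    (subst (_< (1ℚ + x) * pow n 4) (sym (*-zeroˡ (pow n 4)))
      (<-by-positive-polynomial (baseCoefficients S) gap (0≤ℕ→ℚ j)))
    where
    open ≡-Reasoning
    gap : (1ℚ + x) * pow n 4 ≡ 0ℚ + horner (baseCoefficients S) J
    gap = begin
      (1ℚ + x) * pow n 4        ≡⟨ *-distribʳ-+ (pow n 4) 1ℚ x ⟩
      1ℚ * pow n 4 + x * pow n 4 ≡⟨ cong₂ _+_ (*-identityˡ (pow n 4)) x*n⁴≡z ⟩
      pow n 4 + z n              ≡⟨ cong (λ m → pow m 4 + z m) n≡2+J ⟩
      pow (ℕ→ℚ 2 + J) 4 + z (ℕ→ℚ 2 + J) ≡⟨ expand-in-j J S ⟩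
      0ℚ + horner (baseCoefficients S) J ∎
      where
      -- solve-∀ does not unfold definitions, so horner (baseCoefficients s) J is spelled out.
      expand-in-j : ∀ J s → let m = ℕ→ℚ 2 + J in
        m * (m * (m * (m * 1ℚ))) + (- (1ℚ * (½ * (m * m))) - (s - + 1 / 72) * m + + 67 / 100)
        ≡ 0ℚ + ((+ 3307 / 225 - + 2 / 1 * s)
            + J * ((+ 2161 / 72 - s)
              + J * ((+ 47 / 2)
                + J * ((+ 8 / 1)
                  + J * ((+ 1 / 1) + J * 0ℚ)))))
      expand-in-j = solve-∀ ringℚ

  private
    M = pow n 4 * pow n 4 * (pow n 3 * D)

    0<M : 0ℚ < M
    0<M = 0<p*q (0<p*q (0<pow 4 0<n) (0<pow 4 0<n)) (0<p*q (0<pow 3 0<n) (0<ℕ→ℚ+S (suc j)))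

    scaledTruncBinomial : ℚ → ℚ → ℚ → ℚ
    scaledTruncBinomial m d w = d * (pow m 4 * pow m 4 * pow m 3) + d * (pow m 4 * pow m 4) * w
      + ½ * (m - 1ℚ) * pow m 4 * d * (w * w) + + 1 / 6 * (m - 1ℚ) * (m - ℕ→ℚ 2) * d * (w * (w * w))

    truncBinomial*M : truncBinomial x (2 ℕ.+ j) * M ≡ scaledTruncBinomial n D (z n)
    truncBinomial*M = begin
      truncBinomial x (2 ℕ.+ j) * M
        ≡⟨ cong₂ (λ c₂ c₃ → (1ℚ + n * x + c₂ * (x * x) + c₃ * (x * (x * x))) * M)
                 (ℕ→ℚ-nC2 (2 ℕ.+ j)) (ℕ→ℚ-nC3 (2 ℕ.+ j)) ⟩
      (1ℚ + n * x + n * (n - 1ℚ) * ½ * (x * x) + n * (n - 1ℚ) * (n - ℕ→ℚ 2) * (+ 1 / 6) * (x * (x * x))) * M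
        ≡⟨ scale x n D ⟩
      scaledTruncBinomial n D (x * pow n 4)
        ≡⟨ cong (scaledTruncBinomial n D) x*n⁴≡z ⟩
      scaledTruncBinomial n D (z n) ∎
      where
      open ≡-Reasoning
      scale : ∀ x n d → let n³ = n * (n * (n * 1ℚ)) ; n⁴ = n * n³ in
        (1ℚ + n * x + n * (n - 1ℚ) * ½ * (x * x) + n * (n - 1ℚ) * (n - ℕ→ℚ 2) * (+ 1 / 6) * (x * (x * x)))
          * (n⁴ * n⁴ * (n³ * d))
        ≡ d * (n⁴ * n⁴ * n³) + d * (n⁴ * n⁴) * (x * n⁴)
          + ½ * (n - 1ℚ) * n⁴ * d * ((x * n⁴) * (x * n⁴))
          + + 1 / 6 * (n - 1ℚ) * (n - ℕ→ℚ 2) * d * ((x * n⁴) * ((x * n⁴) * (x * n⁴)))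
      scale = solve-∀ ringℚ

    scaledTruncBinomial-gap :
      scaledTruncBinomial n D (z n) ≡ ratio (2 ℕ.+ j) * M + horner (gapCoefficients S) J
    scaledTruncBinomial-gap = begin
      scaledTruncBinomial n D (z n)
        ≡⟨ cong₂ (λ m K → scaledTruncBinomial m (K + S) (z m)) n≡2+J (ℕ→ℚ-suc j) ⟩
      scaledTruncBinomial (ℕ→ℚ 2 + J) ((1ℚ + J) + S) (z (ℕ→ℚ 2 + J))
        ≡⟨ expand-in-j J S ⟩
      ratioNumerator (ℕ→ℚ 2 + J) * (pow (ℕ→ℚ 2 + J) 4 * pow (ℕ→ℚ 2 + J) 4) + G
        ≡⟨ cong (λ m → ratioNumerator m * (pow m 4 * pow m 4) + G) n≡2+J ⟨
      ratioNumerator n * (pow n 4 * pow n 4) + G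
        ≡⟨ cong (_+ G) ratio*M ⟨
      ratio (2 ℕ.+ j) * M + G ∎
      where
      open ≡-Reasoning
      G = horner (gapCoefficients S) J
      regroup : ∀ r n⁴ n³d → r * (n⁴ * n⁴ * n³d) ≡ r * n³d * (n⁴ * n⁴)
      regroup = solve-∀ ringℚ
      ratio*M : ratio (2 ℕ.+ j) * M ≡ ratioNumerator n * (pow n 4 * pow n 4)
      ratio*M = trans (regroup (ratio (2 ℕ.+ j)) (pow n 4) (pow n 3 * D))
                      (cong (_* (pow n 4 * pow n 4)) (ratio-suc (suc j)))
      expand-in-j : ∀ J s →
        let m = ℕ→ℚ 2 + J
            d = (1ℚ + J) + s
            m³ = m * (m * (m * 1ℚ))
            m⁴ = m * m³
            w = - (1ℚ * (½ * (m * m))) - (s - + 1 / 72) * m + + 67 / 100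
        in d * (m⁴ * m⁴ * m³) + d * (m⁴ * m⁴) * w
             + ½ * (m - 1ℚ) * m⁴ * d * (w * w) + + 1 / 6 * (m - 1ℚ) * (m - ℕ→ℚ 2) * d * (w * (w * w))
           ≡ (m - + 1 / 6) * (m - + 1 / 2) * (m - + 5 / 6) * (m + s) * (m⁴ * m⁴)
             + ((+ 4329992 / 50625 + + 22099592 / 50625 * s - + 98624 / 225 * (s * s) + + 32 / 1 * (s * s * s))
                  + J * ((+ 30131305543 / 68343750 + + 133426365193 / 68343750 * s - + 98156599 / 50625 * (s * s) + + 27914 / 225 * (s * s * s) - + 4 / 3 * (s * s * s * s))
                    + J * ((+ 544553371513 / 546750000 + + 2138572515269 / 546750000 * s - + 194233036 / 50625 * (s * s) + + 181937 / 900 * (s * s * s) - + 10 / 3 * (s * s * s * s))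
                      + J * ((+ 5688834601777 / 4374000000 + + 89530228243 / 19440000 * s - + 535822859 / 120000 * (s * s) + + 2722 / 15 * (s * s * s) - + 3 / 1 * (s * s * s * s))
                        + J * ((+ 1519391391121 / 1399680000 + + 982226007389 / 279936000 * s - + 873715171 / 259200 * (s * s) + + 353581 / 3600 * (s * s * s) - + 7 / 6 * (s * s * s * s))
                          + J * ((+ 421219739311 / 699840000 + + 2508210203701 / 1399680000 * s - + 88754333 / 51840 * (s * s) + + 4669 / 144 * (s * s * s) - + 1 / 6 * (s * s * s * s))
                            + J * ((+ 310797894001 / 1399680000 + + 317755547 / 518400 * s - + 351127 / 600 * (s * s) + + 73 / 12 * (s * s * s))
                              + J * ((+ 1010489 / 19200 + + 35060803 / 259200 * s - + 1169 / 9 * (s * s) + + 1 / 2 * (s * s * s))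
                                + J * ((+ 1886731 / 259200 + + 15703 / 900 * s - + 17 / 1 * (s * s))
                                  + J * ((+ 403 / 900 + s - (s * s)) + J * 0ℚ))))))))))
      expand-in-j = solve-∀ ringℚ

  ratio<truncBinomial : ratio (2 ℕ.+ j) < truncBinomial x (2 ℕ.+ j)
  ratio<truncBinomial = *-cancelʳ-< 0<M
    (<-by-positive-polynomial (gapCoefficients S) (trans truncBinomial*M scaledTruncBinomial-gap) (0≤ℕ→ℚ j))

ratio<exp : ∀ j → ratio (2 ℕ.+ j) <exp exponent (2 ℕ.+ j)
ratio<exp j = 2 ℕ.+ j , ℕ.s≤s ℕ.z≤n , 0<1+x
            , <-≤-trans ratio<truncBinomial (truncBinomial≤pow (<⇒≤ 0<1+x) (2 ℕ.+ j))
  where open ExpBound j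

lemma1 : (n : ℕ) → 1 ℕ.≤ n →
    ∃[ φ ] ((+ 1 / 20 < φ × φ < + 219 / 100)
      × ratio n ≡ 1ℚ - 1ℚ ÷₀ (ℕ→ℚ (2 ℕ.* n))
                 + (+ 5 / 36 - S) ÷₀ pow (ℕ→ℚ n) 2
                 + (+ 5 / 72 - S ÷₀ ℕ→ℚ 2 + S * S) ÷₀ pow (ℕ→ℚ n) 3
                 + φ ÷₀ pow (ℕ→ℚ n) 4
      × (2 ℕ.≤ n →
          φ < + 11 / 100
          × ratio n <exp (- (1ℚ ÷₀ ℕ→ℚ (2 ℕ.* n))
                          - (S - + 1 / 72) ÷₀ pow (ℕ→ℚ n) 2
                          + (+ 67 / 100) ÷₀ pow (ℕ→ℚ n) 3)))
lemma1 (suc zero)    _ = φ 1 , φ-bounds 0 , ratio-expansion 0 , λ { (ℕ.s≤s ()) }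
lemma1 (suc (suc j)) _ =
  φ (2 ℕ.+ j) , φ-bounds (suc j) , ratio-expansion (suc j) , λ _ → φ<11/100 j , ratio<exp j
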